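{- If $K_6$ is edge-colored with exactly $10$ colors and contains no rainbow $K_4$, then either $K_6$ contains a rainbow subgraph isomorphic to $T_{6,2}$ (that is, $K_{3,3}$), or $K_6$ contains a monochromatic $C_6$ as a subgraph.
   Context: Edge colorings are arbitrary (not necessarily proper). A subgraph is rainbow if its edges have pairwise distinct colors, and monochromatic if all its edges have the same color. $T_{n,r}$ denotes the Turán graph, the complete $r$-partite graph on $n$ vertices with part sizes differing by at most one. -}

module Defs where

open import Data.Nat using (ℕ)
open import Data.Fin using (Fin; zero; suc)
open import Data.Product using (Σ; ∃; _×_; _,_)
import Data.Product
open import Relation.Binary.PropositionalEquality using (_≡_; _≢_)
open import Function.Definitions using (Injective)

-- An edge colouring of K_n with colours from a type C:
-- a symmetric function on ordered pairs; only values at i ≢ j matter.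
record EdgeColouring (n : ℕ) (C : Set) : Set where
  field
    col : Fin n → Fin n → C
    sym : ∀ i j → col i j ≡ col j i

open EdgeColouring public

-- Uses exactly the colours of C: every colour appears on some edge.
-- (With C = Fin k, this says the colouring uses exactly k colours.)
UsesAll : ∀ {n C} → EdgeColouring n C → Set
UsesAll {n} {C} χ = ∀ (c : C) → ∃ λ i → ∃ λ j → (i ≢ j) × col χ i j ≡ c

RainbowEdges : ∀ {n C m} → EdgeColouring n C → (Fin m → Fin n × Fin n) → Set
RainbowEdges {n} {C} {m} χ e =
  Injective _≡_ _≡_ (λ (k : Fin m) → colE (e k))
  where
  colE : Fin n × Fin n → C
  colE (i , j) = col χ i j

Embedding : ℕ → ℕ → Set
Embedding k n = Σ (Fin k → Fin n) (Injective _≡_ _≡_)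

K4-edges : Fin 6 → Fin 4 × Fin 4
K4-edges zero = (zero , suc zero)
K4-edges (suc zero) = (zero , suc (suc zero))
K4-edges (suc (suc zero)) = (zero , suc (suc (suc zero)))
K4-edges (suc (suc (suc zero))) = (suc zero , suc (suc zero))
K4-edges (suc (suc (suc (suc zero)))) = (suc zero , suc (suc (suc zero)))
K4-edges (suc (suc (suc (suc (suc zero))))) = (suc (suc zero) , suc (suc (suc zero)))

v0 v1 v2 v3 v4 v5 : Fin 6
v0 = zero
v1 = suc zero
v2 = suc (suc zero)
v3 = suc (suc (suc zero))
v4 = suc (suc (suc (suc zero)))
v5 = suc (suc (suc (suc (suc zero))))

K33-edges : Fin 9 → Fin 6 × Fin 6
K33-edges zero = (v0 , v3)
K33-edges (suc zero) = (v0 , v4)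
K33-edges (suc (suc zero)) = (v0 , v5)
K33-edges (suc (suc (suc zero))) = (v1 , v3)
K33-edges (suc (suc (suc (suc zero)))) = (v1 , v4)
K33-edges (suc (suc (suc (suc (suc zero))))) = (v1 , v5)
K33-edges (suc (suc (suc (suc (suc (suc zero)))))) = (v2 , v3)
K33-edges (suc (suc (suc (suc (suc (suc (suc zero))))))) = (v2 , v4)
K33-edges (suc (suc (suc (suc (suc (suc (suc (suc zero)))))))) = (v2 , v5)

C6-edges : Fin 6 → Fin 6 × Fin 6
C6-edges zero = (v0 , v1)
C6-edges (suc zero) = (v1 , v2)
C6-edges (suc (suc zero)) = (v2 , v3)
C6-edges (suc (suc (suc zero))) = (v3 , v4)
C6-edges (suc (suc (suc (suc zero)))) = (v4 , v5)
C6-edges (suc (suc (suc (suc (suc zero))))) = (v5 , v0)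

mapE : ∀ {k n m} → (Fin k → Fin n) → (Fin m → Fin k × Fin k) → Fin m → Fin n × Fin n
mapE f e x with e x
... | (a , b) = (f a , f b)

HasRainbowCopy : ∀ {n C k m} → EdgeColouring n C → (Fin m → Fin k × Fin k) → Set
HasRainbowCopy {n} {C} {k} χ e =
  ∃ λ (f : Embedding k n) → RainbowEdges χ (mapE (Data.Product.proj₁ f) e)

HasMonochromaticCopy : ∀ {n C k m} → EdgeColouring n C → (Fin m → Fin k × Fin k) → Set
HasMonochromaticCopy {n} {C} {k} {m} χ e =
  ∃ λ (f : Embedding k n) → ∃ λ (c : C) →
    ∀ (x : Fin m) → colP (mapE (Data.Product.proj₁ f) e x) ≡ c
  where
  colP : Fin n × Fin n → C
  colP (i , j) = col χ i j

-- Only the partition of the 15 edges into colour classes matters, so replace the colouring by the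
-- labelling ρ that sends each edge to the first edge (in a fixed numbering) of the same colour.
-- Then ρ ∘ ρ = ρ, ρ e ≤ e, the fixed points of ρ are one edge per colour (so there are at least
-- ten of them), and rainbow and monochromatic copies are the same for the colouring and for ρ.
-- It remains to check every such ρ without a rainbow K₄, a finite search: guess the set of fixed
-- points (at least ten edges, no K₄ among them, since fixed points have distinct labels), then send
-- each of the at most five remaining edges to an earlier fixed point, discarding a branch as soon as
-- some K₄ has become rainbow. It turns out that every surviving labelling has nine singleton classes
-- and one class of six edges forming either a 6-cycle or two disjoint triangles, whose complement is
-- a rainbow K₃,₃.
module Submission where

open import Data.Bool using (Bool; true; false; T; not; _∧_; _∨_)
open import Data.Bool.ListAction using (all; any)
open import Data.Bool.Properties using (T-∧; T-∨; T-≡; T?)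
open import Data.Empty using (⊥-elim)
open import Data.Fin using (Fin; zero; suc; #_; toℕ; fromℕ<; inject; _≤_; _≤?_)
open import Data.Fin.Properties
  using (_≟_; all?; ¬∀⟶∃¬-smallest; ≤-antisym; toℕ-injective; toℕ-inject; toℕ-fromℕ<; injective⇒≤)
open import Data.List using (List; []; _∷_; map; _++_; filter; filterᵇ; length)
import Data.List as List
open import Data.List.Membership.Propositional using (_∈_; _∉_; find)
open import Data.List.Membership.Propositional.Properties
  using (∈-filter⁺; ∈-filter⁻; ∈-map⁺; ∈-map⁻; ∈-++⁺ˡ; ∈-++⁺ʳ; ∈-allFin; ∈-tabulate⁺)
open import Data.List.Properties using (map-tabulate; map-cong-local; map-id-local)
open import Data.List.Relation.Binary.Sublist.Propositional using (_⊆_; []; _∷_; _∷ʳ_)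
open import Data.List.Relation.Binary.Sublist.Propositional.Properties using (filter-⊆)
open import Data.List.Relation.Unary.All as All using (All; []; _∷_)
import Data.List.Relation.Unary.All.Properties as All
open import Data.List.Relation.Unary.Any using (here; there)
import Data.List.Relation.Unary.Any as Any
import Data.List.Relation.Unary.Any.Properties as Any
open import Data.Nat using (ℕ; _+_; _≤ᵇ_)
import Data.Nat as ℕ
import Data.Nat.Properties as ℕ
open import Data.Product using (∃; _×_; _,_; proj₁; proj₂; uncurry)
open import Data.Product.Properties using (≡-dec)
open import Data.Sum using (_⊎_; inj₁; inj₂)
import Data.Sum as Sum
open import Data.Vec using (Vec; []; _∷_; lookup; tabulate; allFin; insertAt; _[_]≔_)
open import Data.Vec.Properties using (lookup∘update; lookup∘update′; lookup-allFin; lookup∘tabulate)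
open import Function using (id; _∘_)
open import Function.Bundles using (Equivalence)
open import Function.Definitions using (Injective)
open import Relation.Binary.Definitions using (DecidableEquality)
open import Relation.Binary.PropositionalEquality as ≡ using (_≡_; _≢_; refl)
open import Relation.Nullary using (¬_; Dec; yes; no; ¬?; contradiction)
open import Relation.Nullary.Decidable
  using (⌊_⌋; from-yes; map′; _×-dec_; _⊎-dec_; _→-dec_; toWitness; fromWitness; decidable-stable)

open import Defs

-- Edges of K₆ and copies of patterns

ends : Fin 15 → Fin 6 × Fin 6
ends = lookup ( (# 0 , # 1) ∷ (# 0 , # 2) ∷ (# 1 , # 2) ∷ (# 0 , # 3) ∷ (# 1 , # 3)
              ∷ (# 2 , # 3) ∷ (# 0 , # 4) ∷ (# 1 , # 4) ∷ (# 2 , # 4) ∷ (# 3 , # 4)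
              ∷ (# 0 , # 5) ∷ (# 1 , # 5) ∷ (# 2 , # 5) ∷ (# 3 , # 5) ∷ (# 4 , # 5) ∷ [])

-- The diagonal entries are junk: edge i i is only ever used for i ≢ j.
edge : Fin 6 → Fin 6 → Fin 15
edge i j = lookup (lookup table i) j
  where
  table : Vec (Vec (Fin 15) 6) 6
  table = (# 0  ∷ # 0  ∷ # 1  ∷ # 3  ∷ # 6  ∷ # 10 ∷ [])
        ∷ (# 0  ∷ # 0  ∷ # 2  ∷ # 4  ∷ # 7  ∷ # 11 ∷ [])
        ∷ (# 1  ∷ # 2  ∷ # 0  ∷ # 5  ∷ # 8  ∷ # 12 ∷ [])
        ∷ (# 3  ∷ # 4  ∷ # 5  ∷ # 0  ∷ # 9  ∷ # 13 ∷ [])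
        ∷ (# 6  ∷ # 7  ∷ # 8  ∷ # 9  ∷ # 0  ∷ # 14 ∷ [])
        ∷ (# 10 ∷ # 11 ∷ # 12 ∷ # 13 ∷ # 14 ∷ # 0  ∷ [])
        ∷ []

ends∘edge : ∀ i j → i ≢ j → ends (edge i j) ≡ (i , j) ⊎ ends (edge i j) ≡ (j , i)
ends∘edge = from-yes (all? λ i → all? λ j →
  ¬? (i ≟ j) →-dec (ends (edge i j) ≟₂ (i , j) ⊎-dec ends (edge i j) ≟₂ (j , i)))
  where
  _≟₂_ : DecidableEquality (Fin 6 × Fin 6)
  _≟₂_ = ≡-dec _≟_ _≟_

edgeColour : ∀ {C : Set} → EdgeColouring 6 C → Fin 15 → C
edgeColour χ = uncurry (col χ) ∘ ends

col≡edgeColour : ∀ {C : Set} (χ : EdgeColouring 6 C) {i j} → i ≢ j → col χ i j ≡ edgeColour χ (edge i j)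
col≡edgeColour χ {i} {j} i≢j with ends (edge i j) | ends∘edge i j i≢j
... | _ | inj₁ refl = refl
... | _ | inj₂ refl = sym χ i j

copyEdges : ∀ {k m} → Vec (Fin 6) k → (Fin m → Fin k × Fin k) → Fin m → Fin 15
copyEdges v e x = edge (lookup v (proj₁ (e x))) (lookup v (proj₂ (e x)))

RainbowCopyIn : ∀ {C : Set} {k m} → (Fin 15 → C) → (Fin m → Fin k × Fin k) → Set
RainbowCopyIn κ e = ∃ λ v → Injective _≡_ _≡_ (lookup v) × Injective _≡_ _≡_ (κ ∘ copyEdges v e)

MonochromaticCopyIn : ∀ {C : Set} {k m} → (Fin 15 → C) → (Fin m → Fin k × Fin k) → Set
MonochromaticCopyIn κ e = ∃ λ v → Injective _≡_ _≡_ (lookup v) × ∃ λ c → ∀ x → κ (copyEdges v e x) ≡ c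

rainbowCopyIn-reflect : ∀ {C D : Set} {k m} {κ : Fin 15 → C} {κ′ : Fin 15 → D} {e : Fin m → Fin k × Fin k} →
                        (∀ {a b} → κ a ≡ κ b → κ′ a ≡ κ′ b) → RainbowCopyIn κ′ e → RainbowCopyIn κ e
rainbowCopyIn-reflect κ⇒κ′ (v , v-inj , rainbow) = v , v-inj , rainbow ∘ κ⇒κ′

monochromaticCopyIn-map : ∀ {C D : Set} {k m} {κ : Fin 15 → C} {κ′ : Fin 15 → D} {e : Fin m → Fin k × Fin k} →
                          (g : D → C) → (∀ a → g (κ′ a) ≡ κ a) →
                          MonochromaticCopyIn κ′ e → MonochromaticCopyIn κ e
monochromaticCopyIn-map g g∘κ′≗κ (v , v-inj , c , mono) =
  v , v-inj , g c , λ x → ≡.trans (≡.sym (g∘κ′≗κ _)) (≡.cong g (mono x))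

Loopless : ∀ {k m} → (Fin m → Fin k × Fin k) → Set
Loopless e = ∀ x → proj₁ (e x) ≢ proj₂ (e x)

loopless? : ∀ {k m} (e : Fin m → Fin k × Fin k) → Dec (Loopless e)
loopless? e = all? λ x → ¬? (proj₁ (e x) ≟ proj₂ (e x))

K4-loopless : Loopless K4-edges
K4-loopless = from-yes (loopless? K4-edges)

K33-loopless : Loopless K33-edges
K33-loopless = from-yes (loopless? K33-edges)

C6-loopless : Loopless C6-edges
C6-loopless = from-yes (loopless? C6-edges)

module _ {C : Set} (χ : EdgeColouring 6 C) {k m} {e : Fin m → Fin k × Fin k} (loopless : Loopless e) where

  private
    copyColour : ∀ v → Injective _≡_ _≡_ (lookup v) → ∀ x →
                 col χ (lookup v (proj₁ (e x))) (lookup v (proj₂ (e x))) ≡ edgeColour χ (copyEdges v e x)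
    copyColour v v-inj x = col≡edgeColour χ (loopless x ∘ v-inj)

  rainbowCopy : RainbowCopyIn (edgeColour χ) e → HasRainbowCopy χ e
  rainbowCopy (v , v-inj , rainbow) = (lookup v , v-inj) , λ {x} {y} eq →
    rainbow (≡.trans (≡.sym (copyColour v v-inj x)) (≡.trans eq (copyColour v v-inj y)))

  monochromaticCopy : MonochromaticCopyIn (edgeColour χ) e → HasMonochromaticCopy χ e
  monochromaticCopy (v , v-inj , c , mono) =
    (lookup v , v-inj) , c , λ x → ≡.trans (copyColour v v-inj x) (mono x)

-- First occurrences

fixedPoints : ∀ {n} → (Fin n → Fin n) → List (Fin n)
fixedPoints ρ = filter (λ k → ρ k ≟ k) (List.allFin _)

injective⇒≤-length : ∀ {A : Set} {m} {xs : List A} {f : Fin m → A} →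
                     Injective _≡_ _≡_ f → (∀ i → f i ∈ xs) → m ℕ.≤ length xs
injective⇒≤-length {xs = xs} {f} f-inj f∈xs = injective⇒≤ λ {i} {j} eq → f-inj (begin
  f i                                 ≡⟨ Any.lookup-index (f∈xs i) ⟩
  List.lookup xs (Any.index (f∈xs i)) ≡⟨ ≡.cong (List.lookup xs) eq ⟩
  List.lookup xs (Any.index (f∈xs j)) ≡⟨ ≡.sym (Any.lookup-index (f∈xs j)) ⟩
  f j                                 ∎)
  where open ≡.≡-Reasoning

module FirstOccurrence {n m} (c : Fin n → Fin m) where

  private
    least : ∀ k → ∃ λ i → ¬ c i ≢ c k × (∀ (j : Fin (toℕ i)) → c (inject j) ≢ c k)
    least k = ¬∀⟶∃¬-smallest n (λ i → c i ≢ c k) (λ i → ¬? (c i ≟ c k)) (λ ≢ck → ≢ck k refl)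

  rep : Fin n → Fin n
  rep k = proj₁ (least k)

  rep-colour : ∀ k → c (rep k) ≡ c k
  rep-colour k = decidable-stable (c (rep k) ≟ c k) (proj₁ (proj₂ (least k)))

  rep-least : ∀ {j k} → c j ≡ c k → rep k ≤ j
  rep-least {j} {k} cj≡ck with rep k ≤? j
  ... | yes rep≤j = rep≤j
  ... | no  rep≰j =
    contradiction (≡.subst (λ i → c i ≡ c k) (≡.sym inject-j′) cj≡ck) (proj₂ (proj₂ (least k)) j′)
    where
    j′ : Fin (toℕ (rep k))
    j′ = fromℕ< (ℕ.≰⇒> rep≰j)
    inject-j′ : inject j′ ≡ j
    inject-j′ = toℕ-injective (≡.trans (toℕ-inject j′) (toℕ-fromℕ< _))

  rep-≤ : ∀ k → rep k ≤ k
  rep-≤ k = rep-least refl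

  rep-cong : ∀ {i j} → c i ≡ c j → rep i ≡ rep j
  rep-cong {i} {j} ci≡cj = ≤-antisym (rep-least (≡.trans (rep-colour j) (≡.sym ci≡cj)))
                                     (rep-least (≡.trans (rep-colour i) ci≡cj))

  rep-idem : ∀ k → rep (rep k) ≡ rep k
  rep-idem k = rep-cong (rep-colour k)

  surjective⇒many-fixedPoints : (∀ x → ∃ λ k → c k ≡ x) → m ℕ.≤ length (fixedPoints rep)
  surjective⇒many-fixedPoints surj = injective⇒≤-length first-injective first∈
    where
    first : Fin m → Fin n
    first x = rep (proj₁ (surj x))
    first-injective : Injective _≡_ _≡_ first
    first-injective {x} {y} eq = begin
      x                  ≡⟨ ≡.sym (proj₂ (surj x)) ⟩
      c (proj₁ (surj x)) ≡⟨ ≡.sym (rep-colour _) ⟩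
      c (first x)        ≡⟨ ≡.cong c eq ⟩
      c (first y)        ≡⟨ rep-colour _ ⟩
      c (proj₁ (surj y)) ≡⟨ proj₂ (surj y) ⟩
      y                  ∎
      where open ≡.≡-Reasoning
    first∈ : ∀ x → first x ∈ fixedPoints rep
    first∈ x = ∈-filter⁺ (λ k → rep k ≟ k) (∈-allFin _) (rep-idem _)

-- The search

all-lookup : ∀ {A : Set} (p : A → Bool) xs → all p xs ≡ true → ∀ {x} → x ∈ xs → T (p x)
all-lookup p xs all≡true = All.lookup (All.all⁺ p xs (Equivalence.from T-≡ all≡true))

T-not⁺ : ∀ {b} → ¬ T b → T (not b)
T-not⁺ {false} _  = _
T-not⁺ {true}  ¬t = ¬t _

T-not⁻ : ∀ {b} → T (not b) → ¬ T b
T-not⁻ {false} _ ()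

infix 4 _∈ᵇ_

_∈ᵇ_ : Fin 15 → List (Fin 15) → Bool
x ∈ᵇ xs = any (λ y → ⌊ x ≟ y ⌋) xs

distinct : List (Fin 15) → Bool
distinct []       = true
distinct (x ∷ xs) = not (x ∈ᵇ xs) ∧ distinct xs

constant : List (Fin 15) → Bool
constant []       = true
constant (x ∷ xs) = all (λ y → ⌊ x ≟ y ⌋) xs

∈ᵇ⇒∈ : ∀ {x xs} → T (x ∈ᵇ xs) → x ∈ xs
∈ᵇ⇒∈ {x} {xs} = Any.map (λ {y} → toWitness {a? = x ≟ y}) ∘ Any.any⁻ _ xs

∈⇒∈ᵇ : ∀ {x xs} → x ∈ xs → T (x ∈ᵇ xs)
∈⇒∈ᵇ {x} = Any.any⁺ _ ∘ Any.map (λ {y} → fromWitness {a? = x ≟ y})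

distinct⇒∉ : ∀ {x xs} → T (distinct (x ∷ xs)) → x ∉ xs
distinct⇒∉ {x} {xs} d = T-not⁻ (proj₁ (Equivalence.to (T-∧ {not (x ∈ᵇ xs)}) d)) ∘ ∈⇒∈ᵇ

distinct-tail : ∀ {x xs} → T (distinct (x ∷ xs)) → T (distinct xs)
distinct-tail {x} {xs} = proj₂ ∘ Equivalence.to (T-∧ {not (x ∈ᵇ xs)})

distinct⇒injective : ∀ {m} (f : Fin m → Fin 15) → T (distinct (List.tabulate f)) → Injective _≡_ _≡_ f
distinct⇒injective {ℕ.suc m} f d {zero}  {zero}  _  = refl
distinct⇒injective {ℕ.suc m} f d {zero}  {suc y} eq =
  ⊥-elim (distinct⇒∉ d (≡.subst (_∈ List.tabulate (f ∘ suc)) (≡.sym eq) (∈-tabulate⁺ y)))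
distinct⇒injective {ℕ.suc m} f d {suc x} {zero}  eq =
  ⊥-elim (distinct⇒∉ d (≡.subst (_∈ List.tabulate (f ∘ suc)) eq (∈-tabulate⁺ x)))
distinct⇒injective {ℕ.suc m} f d {suc x} {suc y} eq =
  ≡.cong suc (distinct⇒injective (f ∘ suc) (distinct-tail {f zero} {List.tabulate (f ∘ suc)} d) eq)

constant⇒≡head : ∀ {m} (f : Fin (ℕ.suc m) → Fin 15) → T (constant (List.tabulate f)) → ∀ x → f x ≡ f zero
constant⇒≡head f h zero    = refl
constant⇒≡head f h (suc x) = ≡.sym (toWitness {a? = f zero ≟ f (suc x)} (All.tabulate⁻ (All.all⁺ _ _ h) x))

-- Sublists of xs omitting at most `budget` elements, built from the back; `keep y zs` may veto
-- putting y in front of zs. The recursive result is passed to `extend` so that it is computed once.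
module _ {A : Set} (keep : A → List A → Bool) (budget : ℕ) where

  admissibleSublists : List A → List (List A)
  admissibleSublists []       = [] ∷ []
  admissibleSublists (x ∷ xs) = extend (admissibleSublists xs)
    where
    extend : List (List A) → List (List A)
    extend ls = map (x ∷_) (filterᵇ (keep x) ls)
             ++ filterᵇ (λ l → length (x ∷ xs) ≤ᵇ budget + length l) ls

  admissibleSublists-complete : ∀ {P : A → Set} → (∀ {y zs} → P y → All P zs → T (keep y zs)) →
                                ∀ {ys xs} → ys ⊆ xs → All P ys → length xs ℕ.≤ budget + length ys →
                                ys ∈ admissibleSublists xs
  admissibleSublists-complete keep-sound [] [] _ = here refl
  admissibleSublists-complete keep-sound (x ∷ʳ ys⊆xs) pys long =
    ∈-++⁺ʳ _ (∈-filter⁺ (T? ∘ _) (admissibleSublists-complete keep-sound ys⊆xs pys (ℕ.<⇒≤ long))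
                                (ℕ.≤⇒≤ᵇ long))
  admissibleSublists-complete keep-sound {y ∷ ys} {_ ∷ xs} (refl ∷ ys⊆xs) (py ∷ pys) long =
    ∈-++⁺ˡ (∈-map⁺ (y ∷_) (∈-filter⁺ (T? ∘ keep y) (admissibleSublists-complete keep-sound ys⊆xs pys long′)
                                                   (keep-sound py pys)))
    where
    long′ : length xs ℕ.≤ budget + length ys
    long′ = ℕ.s≤s⁻¹ (≡.subst (length (y ∷ xs) ℕ.≤_) (ℕ.+-suc budget (length ys)) long)

injective? : ∀ {m n} (f : Fin m → Fin n) → Dec (Injective _≡_ _≡_ f)
injective? f = map′ (λ inj → inj _ _) (λ inj _ _ → inj) (all? λ x → all? λ y → (f x ≟ f y) →-dec (x ≟ y))

unorderedPairs : ∀ {A : Set} → List A → List (A × A)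
unorderedPairs []       = []
unorderedPairs (x ∷ xs) = map (x ,_) xs ++ unorderedPairs xs

quadsThrough : Fin 15 → List (Vec (Fin 6) 4)
quadsThrough k = map (λ (c , d) → a ∷ b ∷ c ∷ d ∷ []) (unorderedPairs others)
  where
  a = proj₁ (ends k)
  b = proj₂ (ends k)
  others = filterᵇ (λ w → not ⌊ w ≟ a ⌋ ∧ not ⌊ w ≟ b ⌋) (List.allFin 6)

quadsThrough-proper : ∀ k → All (λ v → Injective _≡_ _≡_ (lookup v) × copyEdges v K4-edges zero ≡ k)
                                (quadsThrough k)
quadsThrough-proper = from-yes (all? λ k →
  All.all? (λ v → injective? (lookup v) ×-dec (copyEdges v K4-edges zero ≟ k)) (quadsThrough k))

otherEdges : Vec (Fin 6) 4 → List (Fin 15)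
otherEdges v = List.tabulate (copyEdges v K4-edges ∘ suc)

permutations : ∀ {A : Set} {n} → Vec A n → List (Vec A n)
permutations []       = [] ∷ []
permutations (x ∷ xs) = List.concatMap (λ p → map (λ i → insertAt p i x) (List.allFin _)) (permutations xs)

-- Every K₃,₃ and every C₆ in K₆ is placed by a vertex ordering starting at vertex 0.
orderings : List (Vec (Fin 6) 6)
orderings = map (zero ∷_) (permutations (tabulate suc))

orderings-injective : All (Injective _≡_ _≡_ ∘ lookup) orderings
orderings-injective = from-yes (All.all? (injective? ∘ lookup) orderings)

-- The search takes the table as an argument so that the normaliser builds it only once.
QuadTable : Set
QuadTable = Vec (List (List (Fin 15))) 15

quadTable : QuadTable
quadTable = tabulate (map otherEdges ∘ quadsThrough)

∈-quadTable : ∀ k {es} → es ∈ lookup quadTable k → ∃ λ v → v ∈ quadsThrough k × es ≡ otherEdges v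
∈-quadTable k = ∈-map⁻ otherEdges ∘ ≡.subst (_ ∈_) (lookup∘tabulate (map otherEdges ∘ quadsThrough) k)

Labelling : Set
Labelling = Vec (Fin 15) 15

colours : ∀ {k m} → Labelling → (Fin m → Fin k × Fin k) → Vec (Fin 6) k → List (Fin 15)
colours r e v = List.tabulate (lookup r ∘ copyEdges v e)

hasRainbowK33OrMonoC6 : Labelling → Bool
hasRainbowK33OrMonoC6 r =
  any (λ v → distinct (colours r K33-edges v) ∨ constant (colours r C6-edges v)) orderings

quadFree : QuadTable → Fin 15 → List (Fin 15) → Bool
quadFree Q y zs = not (any (λ es → all (_∈ᵇ zs) es ∧ distinct (y ∷ es)) (lookup Q y))

settled : List (Fin 15) → List (Fin 15) → Bool
settled todo es = not (any (_∈ᵇ todo) es)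

-- If the other five edges of a K₄ through k already carry five distinct labels, then k must
-- receive one of them.
blockers : QuadTable → Labelling → Fin 15 → List (Fin 15) → List (List (Fin 15))
blockers Q r k todo = filterᵇ distinct (map (map (lookup r)) (filterᵇ (settled todo) (lookup Q k)))

admissible : List (List (Fin 15)) → Fin 15 → Fin 15 → Bool
admissible bs k j = ⌊ j ≤? k ⌋ ∧ all (j ∈ᵇ_) bs

options : QuadTable → List (Fin 15) → Labelling → Fin 15 → List (Fin 15) → List (Fin 15)
options Q S r k rest = filterᵇ (admissible (blockers Q r k (k ∷ rest)) k) S

-- S is the guessed set of fixed points; the labelling r starts as the identity and the edges in the
-- last argument are still to be sent to a fixed point.
explore : QuadTable → List (Fin 15) → Labelling → List (Fin 15) → Bool
explore Q S r []         = hasRainbowK33OrMonoC6 r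
explore Q S r (k ∷ rest) = all (λ j → explore Q S (r [ k ]≔ j) rest) (options Q S r k rest)

outside : List (Fin 15) → List (Fin 15)
outside S = filterᵇ (λ e → not (e ∈ᵇ S)) (List.allFin 15)

-- Stated with the search term itself rather than a name for it: elsewhere this type is only ever
-- compared syntactically, never normalised again.
search-succeeds : all (λ S → explore quadTable S (allFin 15) (outside S))
                      (admissibleSublists (quadFree quadTable) 5 (List.allFin 15)) ≡ true
search-succeeds = refl

-- Soundness of the search

hasRainbowK33OrMonoC6-sound : ∀ r → T (hasRainbowK33OrMonoC6 r) →
                              RainbowCopyIn (lookup r) K33-edges ⊎ MonochromaticCopyIn (lookup r) C6-edges
hasRainbowK33OrMonoC6-sound r good =
  Sum.map (λ rainbow → v , v-inj , distinct⇒injective _ rainbow)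
          (λ mono → v , v-inj , _ , constant⇒≡head _ mono)
          (Equivalence.to T-∨ (proj₂ (proj₂ found)))
  where
  placesGoodCopy : Vec (Fin 6) 6 → Bool
  placesGoodCopy v = distinct (colours r K33-edges v) ∨ constant (colours r C6-edges v)
  found : ∃ λ v → v ∈ orderings × T (placesGoodCopy v)
  found = find (Any.any⁻ placesGoodCopy orderings good)
  v : Vec (Fin 6) 6
  v = proj₁ found
  v-inj : Injective _≡_ _≡_ (lookup v)
  v-inj = All.lookup orderings-injective (proj₁ (proj₂ found))

module CanonicalLabelling (ρ : Fin 15 → Fin 15) (ρ-idem : ∀ k → ρ (ρ k) ≡ ρ k) (ρ-≤ : ∀ k → ρ k ≤ k)
                          (no-rainbow-K4 : ¬ RainbowCopyIn ρ K4-edges) where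

  Fixed : Fin 15 → Set
  Fixed k = ρ k ≡ k

  quad-not-rainbow : ∀ {k es} → es ∈ lookup quadTable k → ¬ T (distinct (ρ k ∷ map ρ es))
  quad-not-rainbow {k} es∈ with ∈-quadTable k es∈
  ... | v , v∈ , refl = λ rainbow →
    no-rainbow-K4 (v , v-inj , distinct⇒injective (ρ ∘ copyEdges v K4-edges)
                                                  (≡.subst (T ∘ distinct) colours≡ rainbow))
    where
    v-inj = proj₁ (All.lookup (quadsThrough-proper k) v∈)
    colours≡ : ρ k ∷ map ρ (otherEdges v) ≡ List.tabulate (ρ ∘ copyEdges v K4-edges)
    colours≡ = ≡.cong₂ _∷_ (≡.cong ρ (≡.sym (proj₂ (All.lookup (quadsThrough-proper k) v∈))))
                           (map-tabulate (copyEdges v K4-edges ∘ suc) ρ)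

  quadFree-sound : ∀ {y zs} → Fixed y → All Fixed zs → T (quadFree quadTable y zs)
  quadFree-sound {y} {zs} ρy≡y fixed-zs = T-not⁺ (no-quad-inside ∘ find ∘ Any.any⁻ inside (lookup quadTable y))
    where
    inside : List (Fin 15) → Bool
    inside es = all (_∈ᵇ zs) es ∧ distinct (y ∷ es)
    no-quad-inside : ¬ (∃ λ es → es ∈ lookup quadTable y × T (inside es))
    no-quad-inside (es , es∈ , es-inside) = quad-not-rainbow es∈ (≡.subst (T ∘ distinct) (≡.sym fixed) rainbow)
      where
      es⊆zs = proj₁ (Equivalence.to (T-∧ {all (_∈ᵇ zs) es}) es-inside)
      rainbow = proj₂ (Equivalence.to (T-∧ {all (_∈ᵇ zs) es}) es-inside)
      fixed : ρ y ∷ map ρ es ≡ y ∷ es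
      fixed = ≡.cong₂ _∷_ ρy≡y (map-id-local (All.map (All.lookup fixed-zs ∘ ∈ᵇ⇒∈) (All.all⁺ _ es es⊆zs)))

  Agrees : Labelling → List (Fin 15) → Set
  Agrees r todo = ∀ e → e ∉ todo → ρ e ≡ lookup r e

  agrees-update : ∀ {r k rest} → Agrees r (k ∷ rest) → Agrees (r [ k ]≔ ρ k) rest
  agrees-update {r} {k} agrees e e∉rest with e ≟ k
  ... | yes refl = ≡.sym (lookup∘update e r (ρ e))
  ... | no  e≢k  = ≡.trans (agrees e λ { (here e≡k) → e≢k e≡k ; (there e∈rest) → e∉rest e∈rest })
                           (≡.sym (lookup∘update′ e≢k r (ρ k)))

  blockers-sound : ∀ {r k rest b} → Agrees r (k ∷ rest) → b ∈ blockers quadTable r k (k ∷ rest) → T (ρ k ∈ᵇ b)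
  blockers-sound {r} {k} {rest} {b} agrees b∈ = decidable-stable (T? (ρ k ∈ᵇ b)) λ ρk∉ᵇb →
    quad-not-rainbow es∈ (≡.subst (T ∘ distinct ∘ (ρ k ∷_)) b≡
                                  (Equivalence.from T-∧ (T-not⁺ ρk∉ᵇb , b-distinct)))
    where
    candidates : List (List (Fin 15))
    candidates = filterᵇ (settled (k ∷ rest)) (lookup quadTable k)
    b∈′ : b ∈ map (map (lookup r)) candidates × T (distinct b)
    b∈′ = ∈-filter⁻ (T? ∘ distinct) {xs = map (map (lookup r)) candidates} b∈
    b-distinct : T (distinct b)
    b-distinct = proj₂ b∈′
    found : ∃ λ es → es ∈ candidates × b ≡ map (lookup r) es
    found = ∈-map⁻ (map (lookup r)) (proj₁ b∈′)
    es : List (Fin 15)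
    es = proj₁ found
    es∈′ : es ∈ lookup quadTable k × T (settled (k ∷ rest) es)
    es∈′ = ∈-filter⁻ (T? ∘ settled (k ∷ rest)) {xs = lookup quadTable k} (proj₁ (proj₂ found))
    es∈ : es ∈ lookup quadTable k
    es∈ = proj₁ es∈′
    es-settled : All (_∉ k ∷ rest) es
    es-settled = All.tabulate λ e∈es e∈todo →
      T-not⁻ (proj₂ es∈′) (Any.any⁺ _ (Any.map (λ e≡e′ → ≡.subst (T ∘ (_∈ᵇ k ∷ rest)) e≡e′ (∈⇒∈ᵇ e∈todo)) e∈es))
    b≡ : b ≡ map ρ es
    b≡ = ≡.trans (proj₂ (proj₂ found)) (≡.sym (map-cong-local (All.map (agrees _) es-settled)))

  Goal : Set
  Goal = RainbowCopyIn ρ K33-edges ⊎ MonochromaticCopyIn ρ C6-edges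

  explore-sound : ∀ todo r → Agrees r todo → T (explore quadTable (fixedPoints ρ) r todo) → Goal
  explore-sound [] r agrees good =
    Sum.map (rainbowCopyIn-reflect λ {a} {b} eq → ≡.trans (≡.sym (ρ≗r a)) (≡.trans eq (ρ≗r b)))
            (monochromaticCopyIn-map id (≡.sym ∘ ρ≗r))
            (hasRainbowK33OrMonoC6-sound r good)
    where
    ρ≗r : ∀ e → ρ e ≡ lookup r e
    ρ≗r e = agrees e λ ()
  explore-sound (k ∷ rest) r agrees explored =
    explore-sound rest (r [ k ]≔ ρ k) (agrees-update {r} agrees)
      (All.lookup (All.all⁺ (λ j → explore quadTable (fixedPoints ρ) (r [ k ]≔ j) rest)
                            (options quadTable (fixedPoints ρ) r k rest) explored)
                  ρk-option)
    where
    bs : List (List (Fin 15))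
    bs = blockers quadTable r k (k ∷ rest)
    ρk-admissible : T (admissible bs k (ρ k))
    ρk-admissible = Equivalence.from (T-∧ {⌊ ρ k ≤? k ⌋} {all (ρ k ∈ᵇ_) bs})
      (fromWitness (ρ-≤ k) , All.all⁻ (ρ k ∈ᵇ_) {xs = bs} (All.tabulate (blockers-sound {r} agrees)))
    ρk-option : ρ k ∈ options quadTable (fixedPoints ρ) r k rest
    ρk-option = ∈-filter⁺ (T? ∘ admissible bs k) (∈-filter⁺ (λ e → ρ e ≟ e) (∈-allFin (ρ k)) (ρ-idem k))
                          ρk-admissible

  rainbow-K33-or-monochromatic-C6 : 10 ℕ.≤ length (fixedPoints ρ) → Goal
  rainbow-K33-or-monochromatic-C6 enough =
    explore-sound (outside (fixedPoints ρ)) (allFin 15) agrees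
      (all-lookup (λ S → explore quadTable S (allFin 15) (outside S))
                  (admissibleSublists (quadFree quadTable) 5 (List.allFin 15)) search-succeeds fixed∈)
    where
    fixed∈ : fixedPoints ρ ∈ admissibleSublists (quadFree quadTable) 5 (List.allFin 15)
    fixed∈ = admissibleSublists-complete (quadFree quadTable) 5 quadFree-sound
               (filter-⊆ (λ k → ρ k ≟ k) (List.allFin 15)) (All.all-filter (λ k → ρ k ≟ k) (List.allFin 15))
               (ℕ.+-monoʳ-≤ 5 enough)
    agrees : Agrees (allFin 15) (outside (fixedPoints ρ))
    agrees e e∉outside = ≡.trans (proj₂ (∈-filter⁻ (λ k → ρ k ≟ k) e∈fixed)) (≡.sym (lookup-allFin e))
      where
      e∈fixed : e ∈ fixedPoints ρ
      e∈fixed = ∈ᵇ⇒∈ (decidable-stable (T? (e ∈ᵇ fixedPoints ρ)) λ e∉ →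
        e∉outside (∈-filter⁺ (T? ∘ (λ e → not (e ∈ᵇ fixedPoints ρ))) (∈-allFin e) (T-not⁺ e∉)))

lemma4 : (χ : EdgeColouring 6 (Fin 10)) → UsesAll χ →
         ¬ HasRainbowCopy χ K4-edges →
         HasRainbowCopy χ K33-edges ⊎ HasMonochromaticCopy χ C6-edges
lemma4 χ usesAll no-rainbow-K4 =
  Sum.map (rainbowCopy χ K33-loopless ∘ rainbow-in-c)
          (monochromaticCopy χ C6-loopless ∘ monochromatic-in-c)
          (rainbow-K33-or-monochromatic-C6 (surjective⇒many-fixedPoints colour-used))
  where
  c : Fin 15 → Fin 10
  c = edgeColour χ
  open FirstOccurrence c
  rainbow-in-c : ∀ {k m} {e : Fin m → Fin k × Fin k} → RainbowCopyIn rep e → RainbowCopyIn c e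
  rainbow-in-c = rainbowCopyIn-reflect λ {a} {b} → rep-cong {a} {b}
  monochromatic-in-c : ∀ {k m} {e : Fin m → Fin k × Fin k} → MonochromaticCopyIn rep e → MonochromaticCopyIn c e
  monochromatic-in-c = monochromaticCopyIn-map {κ′ = rep} c rep-colour
  open CanonicalLabelling rep rep-idem rep-≤ (no-rainbow-K4 ∘ rainbowCopy χ K4-loopless ∘ rainbow-in-c)
  colour-used : ∀ x → ∃ λ k → c k ≡ x
  colour-used x with usesAll x
  ... | i , j , i≢j , col≡x = edge i j , ≡.trans (≡.sym (col≡edgeColour χ i≢j)) col≡x
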